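{- Let $G$ be a finite bipartite graph and let $v\in V(G)$ be such that at least one pendant vertex is adjacent to $v$ and every non-pendant neighbour of $v$ is 2-layered in $G$. Then $G$ satisfies Frankl's conjecture. Furthermore, $v$ and all of its neighbours are rare in $G$.
   Context: A stable set of a graph is a set of pairwise non-adjacent vertices; it is maximal if no further vertex can be added while keeping it stable. A vertex $x$ of $G$ is rare in $G$ if it lies in at most half of the maximal stable sets of $G$. A pendant vertex is a vertex of degree $1$ in $G$. A vertex $u$ is 2-layered in $G$ if every neighbour of $u$ in $G$ is adjacent to some pendant vertex of $G$. A bipartite graph $G$ satisfies Frankl's conjecture if for every bipartition $(X,Y)$ of $V(G)$ into two stable sets, each of $X$ and $Y$ contains a vertex rare in $G$. -}

module Defs where

open import Data.Bool using (Bool; true; false; _∧_; _∨_; not; T)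
open import Data.Nat using (ℕ; zero; suc; _*_; _≤_)
open import Data.Fin using (Fin)
open import Data.Fin.Subset using (Subset; inside; outside; _∈_; _∉_; ∁)
open import Data.Vec using (Vec; []; _∷_; lookup; _[_]≔_)
open import Data.List using (List; []; _∷_; map; _++_; length; allFin)
open import Data.Product using (Σ; _×_; ∃; _,_)
open import Relation.Nullary using (¬_)
open import Relation.Binary.PropositionalEquality using (_≡_)

record Graph (n : ℕ) : Set where
  field
    adj    : Fin n → Fin n → Bool
    sym    : ∀ i j → adj i j ≡ adj j i
    irrefl : ∀ i → adj i i ≡ false
open Graph public

Adj : ∀ {n} → Graph n → Fin n → Fin n → Set
Adj G i j = adj G i j ≡ true

allᵇ : {A : Set} → (A → Bool) → List A → Bool
allᵇ p []       = true
allᵇ p (a ∷ as) = p a ∧ allᵇ p as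

filterᵇ : {A : Set} → (A → Bool) → List A → List A
filterᵇ p []       = []
filterᵇ p (a ∷ as) with p a
... | true  = a ∷ filterᵇ p as
... | false = filterᵇ p as

allSubsets : (n : ℕ) → List (Subset n)
allSubsets zero    = [] ∷ []
allSubsets (suc n) = map (inside ∷_) (allSubsets n) ++ map (outside ∷_) (allSubsets n)

-- S is stable: no two (not necessarily distinct, but loops are absent) members adjacent
isStable : ∀ {n} → Graph n → Subset n → Bool
isStable {n} G S =
  allᵇ (λ i → allᵇ (λ j → not (lookup S i ∧ lookup S j ∧ adj G i j)) (allFin n)) (allFin n)

isMaximalStable : ∀ {n} → Graph n → Subset n → Bool
isMaximalStable {n} G S =
  isStable G S ∧ allᵇ (λ x → lookup S x ∨ not (isStable G (S [ x ]≔ inside))) (allFin n)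

numMaxStable : ∀ {n} → Graph n → ℕ
numMaxStable {n} G = length (filterᵇ (isMaximalStable G) (allSubsets n))

numMaxStableContaining : ∀ {n} → Graph n → Fin n → ℕ
numMaxStableContaining {n} G x =
  length (filterᵇ (λ S → isMaximalStable G S ∧ lookup S x) (allSubsets n))

Rare : ∀ {n} → Graph n → Fin n → Set
Rare G x = 2 * numMaxStableContaining G x ≤ numMaxStable G

degree : ∀ {n} → Graph n → Fin n → ℕ
degree {n} G v = length (filterᵇ (adj G v) (allFin n))

Pendant : ∀ {n} → Graph n → Fin n → Set
Pendant G v = degree G v ≡ 1

TwoLayered : ∀ {n} → Graph n → Fin n → Set
TwoLayered {n} G u = ∀ w → Adj G u w → Σ (Fin n) λ p → Pendant G p × Adj G w p

IsBipartition : ∀ {n} → Graph n → Subset n → Set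
IsBipartition G X = T (isStable G X) × T (isStable G (∁ X))

Bipartite : ∀ {n} → Graph n → Set
Bipartite {n} G = Σ (Subset n) λ X → IsBipartition G X

SatisfiesFrankl : ∀ {n} → Graph n → Set
SatisfiesFrankl {n} G = ∀ (X : Subset n) → IsBipartition G X →
  (Σ (Fin n) λ x → x ∈ X × Rare G x) × (Σ (Fin n) λ y → y ∉ X × Rare G y)

-- Fix a pendant neighbour p of v. The maps
--   S ↦ (S − v) ∪ (N(v) − N(S − v))   and   T ↦ {v} ∪ (T − N(v))
-- are mutually inverse between the maximal stable sets containing v and those
-- avoiding v: N(v) is stable because G is bipartite, p dominates v in the first
-- image, and in the second image a vertex dominated only through a non-pendant
-- neighbour of v is dominated by a pendant vertex, by 2-layeredness. So v lies
-- in exactly half of the maximal stable sets, and every neighbour of v lies only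
-- in sets avoiding v. Finally, v and p are adjacent, hence on opposite sides of
-- every bipartition, and both are rare.
module Submission where

open import Defs renaming (sym to adj-sym; irrefl to adj-irrefl)
open import Data.Bool using (Bool; true; false; _∧_; _∨_; not; T)
import Data.Bool.Properties as Bool
open import Data.Nat using (ℕ; zero; suc; _+_; _*_; _≤_; z≤n; s≤s) renaming (_≟_ to _≟ℕ_)
open import Data.Nat.Properties
  using (+-suc; +-identityʳ; *-monoʳ-≤; m≤n⇒m≤1+n; ≤-trans; ≤-reflexive; ≤-antisym; module ≤-Reasoning)
open import Data.Fin using (Fin; _≟_)
open import Data.Fin.Properties using (any?)
open import Data.Fin.Subset using (Subset; inside; outside; _∈_; _∉_; _⊆_; _∪_; _─_; ⁅_⁆; _-_)
open import Data.Fin.Subset.Properties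
  using (_∈?_; x∈⁅x⁆; x∈⁅y⁆⇒x≡y; x∉⁅y⁆⇒x≢y; x∈p∪q⁺; x∈p∪q⁻; x∉p⇒x∈∁p; x∈p∧x∉q⇒x∈p─q;
         x∈p∧x≢y⇒x∈p-y; p─q⊆p; p⊆p∪q; ⊆-antisym)
open import Data.Vec using ([]; _∷_; here; there; lookup; tabulate; _[_]≔_)
open import Data.Vec.Properties
  using (∷-injectiveʳ; lookup∘tabulate; lookup⇒[]=; []=⇒lookup; []≔-updates; []≔-minimal; lookup∘update′)
open import Data.List as List using (List; []; _∷_; length; map; _++_; allFin)
open import Data.List.Properties using (length-map; length-++-sucʳ)
open import Data.List.Membership.Propositional using () renaming (_∈_ to _∈ₗ_)
open import Data.List.Membership.Propositional.Properties
  using (∈-∃++; ∈-++⁻; ∈-++⁺ˡ; ∈-++⁺ʳ; ∈-map⁺; ∈-map⁻; ∈-filter⁺; ∈-filter⁻; ∈-allFin)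
open import Data.List.Relation.Binary.Subset.Propositional using () renaming (_⊆_ to _⊆ₗ_)
open import Data.List.Relation.Binary.Disjoint.Propositional using (Disjoint)
open import Data.List.Relation.Unary.Any using (here; there)
open import Data.List.Relation.Unary.All using ([]; _∷_)
open import Data.List.Relation.Unary.AllPairs using ([]; _∷_)
open import Data.List.Relation.Unary.Unique.Propositional using (Unique; tail)
import Data.List.Relation.Unary.Unique.Propositional.Properties as Unique
open import Data.Product using (Σ; ∃-syntax; _×_; _,_; proj₁; proj₂)
open import Data.Sum using (_⊎_; inj₁; inj₂)
open import Data.Empty using (⊥; ⊥-elim)
open import Function using (_∘_; id; flip; Equivalence)
open import Level using (Level)
open import Relation.Nullary using (¬_; Dec; yes; no; does; contradiction)
open import Relation.Nullary.Decidable using (T?; dec-true; _×-dec_)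
open import Relation.Unary using (Pred; Decidable)
open import Relation.Binary.PropositionalEquality

private
  variable
    ℓ : Level
    n : ℕ

unique-⊆⇒length≤ : ∀ {A : Set} {xs ys : List A} → Unique xs → xs ⊆ₗ ys → length xs ≤ length ys
unique-⊆⇒length≤ {xs = []} _ _ = z≤n
unique-⊆⇒length≤ {xs = x ∷ xs} xs! x∷xs⊆ys with ∈-∃++ (x∷xs⊆ys (here refl))
... | ys₁ , ys₂ , refl = ≤-trans (s≤s (unique-⊆⇒length≤ (tail xs!) xs⊆ys₁++ys₂))
                                 (≤-reflexive (sym (length-++-sucʳ ys₁ x ys₂)))
  where
  xs⊆ys₁++ys₂ : xs ⊆ₗ ys₁ ++ ys₂
  xs⊆ys₁++ys₂ z∈xs with ∈-++⁻ ys₁ (x∷xs⊆ys (there z∈xs))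
  ... | inj₁ z∈ys₁ = ∈-++⁺ˡ z∈ys₁
  ... | inj₂ (there z∈ys₂) = ∈-++⁺ʳ ys₁ z∈ys₂
  ... | inj₂ (here refl) = contradiction z∈xs (Unique.Unique[x∷xs]⇒x∉xs xs!)

filterᵇ≡filterᵇ : ∀ {A : Set} (p : A → Bool) xs → filterᵇ p xs ≡ List.filterᵇ p xs
filterᵇ≡filterᵇ p [] = refl
filterᵇ≡filterᵇ p (a ∷ as) with p a
... | true = cong (a ∷_) (filterᵇ≡filterᵇ p as)
... | false = filterᵇ≡filterᵇ p as

module _ {A : Set} where

  ∈-filterᵇ⁺ : ∀ {p : A → Bool} {a xs} → a ∈ₗ xs → T (p a) → a ∈ₗ filterᵇ p xs
  ∈-filterᵇ⁺ {p} {xs = xs} a∈xs pa =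
    subst (_ ∈ₗ_) (sym (filterᵇ≡filterᵇ p xs)) (∈-filter⁺ (T? ∘ p) a∈xs pa)

  ∈-filterᵇ⁻ : ∀ (p : A → Bool) {a} xs → a ∈ₗ filterᵇ p xs → T (p a)
  ∈-filterᵇ⁻ p xs a∈ =
    proj₂ (∈-filter⁻ (T? ∘ p) {xs = xs} (subst (_ ∈ₗ_) (filterᵇ≡filterᵇ p xs) a∈))

  filterᵇ-unique : ∀ (p : A → Bool) {xs} → Unique xs → Unique (filterᵇ p xs)
  filterᵇ-unique p {xs} xs! = subst Unique (sym (filterᵇ≡filterᵇ p xs)) (Unique.filter⁺ (T? ∘ p) xs!)

  length-filterᵇ-∧-split : ∀ (p q : A → Bool) xs →
    length (filterᵇ (λ a → p a ∧ q a) xs) + length (filterᵇ (λ a → p a ∧ not (q a)) xs)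
      ≡ length (filterᵇ p xs)
  length-filterᵇ-∧-split p q [] = refl
  length-filterᵇ-∧-split p q (a ∷ as) with p a | q a
  ... | true  | true  = cong suc (length-filterᵇ-∧-split p q as)
  ... | true  | false = trans (+-suc _ _) (cong suc (length-filterᵇ-∧-split p q as))
  ... | false | _     = length-filterᵇ-∧-split p q as

  length-filterᵇ-mono : ∀ {p q : A → Bool} → (∀ {a} → T (p a) → T (q a)) →
    ∀ xs → length (filterᵇ p xs) ≤ length (filterᵇ q xs)
  length-filterᵇ-mono p⇒q [] = z≤n
  length-filterᵇ-mono {p} {q} p⇒q (a ∷ as) with p a in pa | q a in qa
  ... | true  | true  = s≤s (length-filterᵇ-mono p⇒q as)
  ... | true  | false = ⊥-elim (subst T qa (p⇒q (subst T (sym pa) _)))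
  ... | false | true  = m≤n⇒m≤1+n (length-filterᵇ-mono p⇒q as)
  ... | false | false = length-filterᵇ-mono p⇒q as

T-allᵇ⁻ : ∀ {A : Set} {p : A → Bool} {xs a} → T (allᵇ p xs) → a ∈ₗ xs → T (p a)
T-allᵇ⁻ {p = p} {a′ ∷ _} t (here refl) = proj₁ (Equivalence.to (Bool.T-∧ {p a′}) t)
T-allᵇ⁻ {p = p} {a′ ∷ _} t (there a∈) = T-allᵇ⁻ (proj₂ (Equivalence.to (Bool.T-∧ {p a′}) t)) a∈

T-allᵇ⁺ : ∀ {A : Set} {p : A → Bool} {xs} → (∀ {a} → a ∈ₗ xs → T (p a)) → T (allᵇ p xs)
T-allᵇ⁺ {xs = []} _ = _
T-allᵇ⁺ {xs = a ∷ as} all = Equivalence.from Bool.T-∧ (all (here refl) , T-allᵇ⁺ (all ∘ there))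

∨-not-intro : ∀ {a b} → (¬ T a → T b → ⊥) → T (a ∨ not b)
∨-not-intro {true}          _ = _
∨-not-intro {false} {false} _ = _
∨-not-intro {false} {true}  h = h id _

∨-not-elim : ∀ {a b} → T (a ∨ not b) → ¬ T a → ¬ T b
∨-not-elim {true}          _ ¬a = ⊥-elim (¬a _)
∨-not-elim {false} {false} _ _  = id
∨-not-elim {false} {true}  ()

module _ {A : Set} {xs : List A} (xs! : Unique xs) (∈xs : ∀ a → a ∈ₗ xs) where

  length-filterᵇ-≤-injection : ∀ {p q : A → Bool} (f g : A → A) →
    (∀ {a} → T (p a) → T (q (f a)) × g (f a) ≡ a) →
    length (filterᵇ p xs) ≤ length (filterᵇ q xs)
  length-filterᵇ-≤-injection {p} {q} f g f-inj = begin
    length (filterᵇ p xs)         ≤⟨ unique-⊆⇒length≤ (filterᵇ-unique p xs!) p⊆g[q] ⟩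
    length (map g (filterᵇ q xs)) ≡⟨ length-map g (filterᵇ q xs) ⟩
    length (filterᵇ q xs)         ∎
    where
    open ≤-Reasoning
    p⊆g[q] : filterᵇ p xs ⊆ₗ map g (filterᵇ q xs)
    p⊆g[q] {a} a∈ with f-inj (∈-filterᵇ⁻ p xs a∈)
    ... | qfa , gfa≡a = subst (_∈ₗ map g (filterᵇ q xs)) gfa≡a (∈-map⁺ g (∈-filterᵇ⁺ (∈xs (f a)) qfa))

  length-filterᵇ-≡-bijection : ∀ {p q : A → Bool} (f g : A → A) →
    (∀ {a} → T (p a) → T (q (f a)) × g (f a) ≡ a) →
    (∀ {b} → T (q b) → T (p (g b)) × f (g b) ≡ b) →
    length (filterᵇ p xs) ≡ length (filterᵇ q xs)
  length-filterᵇ-≡-bijection f g f-inj g-inj =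
    ≤-antisym (length-filterᵇ-≤-injection f g f-inj) (length-filterᵇ-≤-injection g f g-inj)

allSubsets-complete : (S : Subset n) → S ∈ₗ allSubsets n
allSubsets-complete [] = here refl
allSubsets-complete {suc n} (inside ∷ S) = ∈-++⁺ˡ (∈-map⁺ (inside ∷_) (allSubsets-complete S))
allSubsets-complete {suc n} (outside ∷ S) =
  ∈-++⁺ʳ (map (inside ∷_) (allSubsets n)) (∈-map⁺ (outside ∷_) (allSubsets-complete S))

allSubsets-unique : ∀ n → Unique (allSubsets n)
allSubsets-unique zero = [] ∷ []
allSubsets-unique (suc n) = Unique.++⁺ (Unique.map⁺ ∷-injectiveʳ (allSubsets-unique n))
  (Unique.map⁺ ∷-injectiveʳ (allSubsets-unique n)) inside-outside-disjoint
  where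
  inside-outside-disjoint : Disjoint (map (inside ∷_) (allSubsets n)) (map (outside ∷_) (allSubsets n))
  inside-outside-disjoint (S∈ , S∈′) with ∈-map⁻ (inside ∷_) S∈ | ∈-map⁻ (outside ∷_) S∈′
  ... | _ , _ , refl | _ , _ , ()

setOf : {P : Pred (Fin n) ℓ} → Decidable P → Subset n
setOf P? = tabulate (does ∘ P?)

module _ {P : Pred (Fin n) ℓ} (P? : Decidable P) where

  ∈-setOf⁺ : ∀ {x} → P x → x ∈ setOf P?
  ∈-setOf⁺ {x} px = lookup⇒[]= x (setOf P?) (trans (lookup∘tabulate _ x) (dec-true (P? x) px))

  ∈-setOf⁻ : ∀ {x} → x ∈ setOf P? → P x
  ∈-setOf⁻ {x} x∈ with P? x | trans (sym (lookup∘tabulate (does ∘ P?) x)) ([]=⇒lookup x∈)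
  ... | yes px | _ = px
  ... | no _   | ()

∈-insert⁻ : ∀ {S : Subset n} {x i} → i ∈ S [ x ]≔ inside → i ≡ x ⊎ i ∈ S
∈-insert⁻ {S = S} {x} {i} i∈ with i ≟ x
... | yes i≡x = inj₁ i≡x
... | no i≢x  = inj₂ (lookup⇒[]= i S (trans (sym (lookup∘update′ i≢x S inside)) ([]=⇒lookup i∈)))

x∈p─q⇒x∉q : ∀ (p q : Subset n) {x} → x ∈ p ─ q → x ∉ q
x∈p─q⇒x∉q (inside ∷ p) (outside ∷ q) here ()
x∈p─q⇒x∉q (s ∷ p) (t ∷ q) (there x∈) (there x∈q) = x∈p─q⇒x∉q p q x∈ x∈q

∈-minus⇒≢ : ∀ {p : Subset n} {x y} → x ∈ p - y → x ≢ y
∈-minus⇒≢ {p = p} {y = y} x∈ = x∉⁅y⁆⇒x≢y (x∈p─q⇒x∉q p ⁅ y ⁆ x∈)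

∈⇒T-lookup : ∀ {S : Subset n} {x} → x ∈ S → T (lookup S x)
∈⇒T-lookup x∈S = Equivalence.from Bool.T-≡ ([]=⇒lookup x∈S)

T-lookup⇒∈ : ∀ {S : Subset n} {x} → T (lookup S x) → x ∈ S
T-lookup⇒∈ {S = S} {x} t = lookup⇒[]= x S (Equivalence.to Bool.T-≡ t)

∉⇒T-not-lookup : ∀ {S : Subset n} {x} → x ∉ S → T (not (lookup S x))
∉⇒T-not-lookup {S = S} {x} x∉S with lookup S x in eq
... | true  = contradiction (lookup⇒[]= x S eq) x∉S
... | false = _

T-not-lookup⇒∉ : ∀ {S : Subset n} {x} → T (not (lookup S x)) → x ∉ S
T-not-lookup⇒∉ t x∈S = subst (T ∘ not) ([]=⇒lookup x∈S) t

-- Stable sets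

module _ {n} (G : Graph n) where

  Adj-sym : ∀ {i j} → Adj G i j → Adj G j i
  Adj-sym {i} {j} ij = trans (adj-sym G j i) ij

  Adj-irrefl : ∀ {i} → ¬ Adj G i i
  Adj-irrefl {i} ii with () ← trans (sym (adj-irrefl G i)) ii

  Adj? : ∀ i j → Dec (Adj G i j)
  Adj? i j = adj G i j Bool.≟ true

  N⟨_⟩ : Fin n → Subset n
  N⟨ v ⟩ = setOf (Adj? v)

  HasNbrIn? : ∀ U x → Dec (∃[ y ] y ∈ U × Adj G x y)
  HasNbrIn? U x = any? λ y → (y ∈? U) ×-dec Adj? x y

  N[_] : Subset n → Subset n
  N[ U ] = setOf (HasNbrIn? U)

  ∈N[]⁺ : ∀ {U x y} → y ∈ U → Adj G x y → x ∈ N[ U ]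
  ∈N[]⁺ {U} y∈U xy = ∈-setOf⁺ (HasNbrIn? U) (_ , y∈U , xy)

  ∈N[]⁻ : ∀ {U x} → x ∈ N[ U ] → ∃[ y ] y ∈ U × Adj G x y
  ∈N[]⁻ {U} = ∈-setOf⁻ (HasNbrIn? U)

  N[]-mono : ∀ {U V} → U ⊆ V → N[ U ] ⊆ N[ V ]
  N[]-mono U⊆V x∈ with y , y∈U , xy ← ∈N[]⁻ x∈ = ∈N[]⁺ (U⊆V y∈U) xy

  Stable : Subset n → Set
  Stable S = ∀ {i j} → i ∈ S → j ∈ S → ¬ Adj G i j

  MaximalStable : Subset n → Set
  MaximalStable S = Stable S × (∀ {x} → x ∉ S → x ∈ N[ S ])

  isStable⇒Stable : ∀ {S} → T (isStable G S) → Stable S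
  isStable⇒Stable {S} t {i} {j} i∈S j∈S ij =
    not-∧∧ ([]=⇒lookup i∈S) ([]=⇒lookup j∈S) ij (T-allᵇ⁻ (T-allᵇ⁻ t (∈-allFin i)) (∈-allFin j))
    where
    not-∧∧ : ∀ {a b c} → a ≡ true → b ≡ true → c ≡ true → ¬ T (not (a ∧ b ∧ c))
    not-∧∧ refl refl refl ()

  Stable⇒isStable : ∀ {S} → Stable S → T (isStable G S)
  Stable⇒isStable {S} st = T-allᵇ⁺ {xs = allFin n} λ {i} _ → T-allᵇ⁺ {xs = allFin n} λ {j} _ →
    not-∧∧-intro {lookup S i} {lookup S j} {adj G i j} λ si sj →
      st (lookup⇒[]= i S si) (lookup⇒[]= j S sj)
    where
    not-∧∧-intro : ∀ {a b c} → (a ≡ true → b ≡ true → c ≡ true → ⊥) → T (not (a ∧ b ∧ c))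
    not-∧∧-intro {false}                  _ = _
    not-∧∧-intro {true} {false}           _ = _
    not-∧∧-intro {true} {true}  {false}   _ = _
    not-∧∧-intro {true} {true}  {true}    h = h refl refl refl

  insert-stable : ∀ {S x} → Stable S → x ∉ N[ S ] → Stable (S [ x ]≔ inside)
  insert-stable st x∉N i∈ j∈ ij with ∈-insert⁻ i∈ | ∈-insert⁻ j∈
  ... | inj₁ refl | inj₁ refl = Adj-irrefl ij
  ... | inj₁ refl | inj₂ j∈S  = x∉N (∈N[]⁺ j∈S ij)
  ... | inj₂ i∈S  | inj₁ refl = x∉N (∈N[]⁺ i∈S (Adj-sym ij))
  ... | inj₂ i∈S  | inj₂ j∈S  = st i∈S j∈S ij

  insert-unstable : ∀ {S x y} → x ∉ S → y ∈ S → Adj G x y → ¬ Stable (S [ x ]≔ inside)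
  insert-unstable {S} {x} {y} x∉S y∈S xy st = st ([]≔-updates S x) ([]≔-minimal S y x y≢x y∈S) xy
    where
    y≢x : y ≢ x
    y≢x refl = x∉S y∈S

  isMaximalStable⇒MaximalStable : ∀ {S} → T (isMaximalStable G S) → MaximalStable S
  isMaximalStable⇒MaximalStable {S} t = stable , dominating
    where
    t∧ = Equivalence.to (Bool.T-∧ {isStable G S}) t

    stable : Stable S
    stable = isStable⇒Stable (proj₁ t∧)

    dominating : ∀ {x} → x ∉ S → x ∈ N[ S ]
    dominating {x} x∉S with x ∈? N[ S ]
    ... | yes x∈N = x∈N
    ... | no  x∉N = ⊥-elim (∨-not-elim (T-allᵇ⁻ (proj₂ t∧) (∈-allFin x)) (x∉S ∘ T-lookup⇒∈)
                                       (Stable⇒isStable (insert-stable stable x∉N)))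

  MaximalStable⇒isMaximalStable : ∀ {S} → MaximalStable S → T (isMaximalStable G S)
  MaximalStable⇒isMaximalStable {S} (stable , dominating) =
    Equivalence.from Bool.T-∧ (Stable⇒isStable stable , T-allᵇ⁺ {xs = allFin n} λ {x} _ →
      ∨-not-intro λ x∉S stable′ →
        let y , y∈S , xy = ∈N[]⁻ (dominating (x∉S ∘ ∈⇒T-lookup))
        in  insert-unstable (x∉S ∘ ∈⇒T-lookup) y∈S xy (isStable⇒Stable stable′))

  pendant-nbr-unique : ∀ {q a b} → Pendant G q → Adj G q a → Adj G q b → a ≡ b
  pendant-nbr-unique {q} {a} {b} deg≡1 qa qb with a ≟ b
  ... | yes a≡b = a≡b
  ... | no  a≢b = contradiction (subst (2 ≤_) deg≡1 (unique-⊆⇒length≤ ((a≢b ∷ []) ∷ [] ∷ []) ab⊆nbrs))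
                                λ { (s≤s ()) }
    where
    ab⊆nbrs : a ∷ b ∷ [] ⊆ₗ filterᵇ (adj G q) (allFin n)
    ab⊆nbrs (here refl)         = ∈-filterᵇ⁺ (∈-allFin a) (Equivalence.from Bool.T-≡ qa)
    ab⊆nbrs (there (here refl)) = ∈-filterᵇ⁺ (∈-allFin b) (Equivalence.from Bool.T-≡ qb)

  module _ {X} (bip : IsBipartition G X) where

    adj-∈⇒∉ : ∀ {a b} → Adj G a b → a ∈ X → b ∉ X
    adj-∈⇒∉ ab a∈X b∈X = isStable⇒Stable (proj₁ bip) a∈X b∈X ab

    adj-∉⇒∈ : ∀ {a b} → Adj G a b → a ∉ X → b ∈ X
    adj-∉⇒∈ {b = b} ab a∉X with b ∈? X
    ... | yes b∈X = b∈X
    ... | no  b∉X = ⊥-elim (isStable⇒Stable (proj₂ bip) (x∉p⇒x∈∁p a∉X) (x∉p⇒x∈∁p b∉X) ab)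

  bipartite-triangle-free : Bipartite G → ∀ {a b c} → Adj G a b → Adj G b c → ¬ Adj G a c
  bipartite-triangle-free (X , bip) {a} ab bc ac with a ∈? X
  ... | yes a∈X = adj-∈⇒∉ bip ac a∈X (adj-∉⇒∈ bip bc (adj-∈⇒∉ bip ab a∈X))
  ... | no  a∉X = adj-∈⇒∉ bip bc (adj-∉⇒∈ bip ab a∉X) (adj-∉⇒∈ bip ac a∉X)

  N⟨⟩-stable : Bipartite G → ∀ v → Stable N⟨ v ⟩
  N⟨⟩-stable bipartite v i∈ j∈ =
    bipartite-triangle-free bipartite (Adj-sym (∈-setOf⁻ (Adj? v) i∈)) (∈-setOf⁻ (Adj? v) j∈)

  -- Counting maximal stable sets

  numMaxStableAvoiding : Fin n → ℕ
  numMaxStableAvoiding x =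
    length (filterᵇ (λ S → isMaximalStable G S ∧ not (lookup S x)) (allSubsets n))

  module _ {S : Subset n} {x : Fin n} where

    containing⁺ : MaximalStable S → x ∈ S → T (isMaximalStable G S ∧ lookup S x)
    containing⁺ ms x∈S = Equivalence.from Bool.T-∧ (MaximalStable⇒isMaximalStable ms , ∈⇒T-lookup x∈S)

    containing⁻ : T (isMaximalStable G S ∧ lookup S x) → MaximalStable S × x ∈ S
    containing⁻ t with ms , x∈S ← Equivalence.to Bool.T-∧ t =
      isMaximalStable⇒MaximalStable ms , T-lookup⇒∈ x∈S

    avoiding⁺ : MaximalStable S → x ∉ S → T (isMaximalStable G S ∧ not (lookup S x))
    avoiding⁺ ms x∉S = Equivalence.from Bool.T-∧ (MaximalStable⇒isMaximalStable ms , ∉⇒T-not-lookup x∉S)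

    avoiding⁻ : T (isMaximalStable G S ∧ not (lookup S x)) → MaximalStable S × x ∉ S
    avoiding⁻ t with ms , x∉S ← Equivalence.to Bool.T-∧ t =
      isMaximalStable⇒MaximalStable ms , T-not-lookup⇒∉ x∉S

  numMaxStable-split : ∀ x → numMaxStableContaining G x + numMaxStableAvoiding x ≡ numMaxStable G
  numMaxStable-split x = length-filterᵇ-∧-split (isMaximalStable G) (λ S → lookup S x) (allSubsets n)

  numMaxStableContaining≤Avoiding-of-adj : ∀ {u v} → Adj G u v →
    numMaxStableContaining G u ≤ numMaxStableAvoiding v
  numMaxStableContaining≤Avoiding-of-adj {u} {v} uv =
    length-filterᵇ-mono (λ {S} → u∈⇒v∉ {S}) (allSubsets n)
    where
    u∈⇒v∉ : ∀ {S} → T (isMaximalStable G S ∧ lookup S u) →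
                     T (isMaximalStable G S ∧ not (lookup S v))
    u∈⇒v∉ {S} t with ms , u∈S ← containing⁻ {S} {u} t =
      avoiding⁺ {S} {v} ms (λ v∈S → proj₁ ms u∈S v∈S uv)

  module _ {v : Fin n} (halved : numMaxStableContaining G v ≡ numMaxStableAvoiding v) where

    twice-containing : 2 * numMaxStableContaining G v ≡ numMaxStable G
    twice-containing = begin
      2 * C                      ≡⟨ cong (C +_) (+-identityʳ C) ⟩
      C + C                      ≡⟨ cong (C +_) halved ⟩
      C + numMaxStableAvoiding v ≡⟨ numMaxStable-split v ⟩
      numMaxStable G             ∎
      where
      open ≡-Reasoning
      C = numMaxStableContaining G v

    rare-of-halved : Rare G v
    rare-of-halved = ≤-reflexive twice-containing

    rare-of-adj-halved : ∀ {u} → Adj G v u → Rare G u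
    rare-of-adj-halved vu =
      ≤-trans (*-monoʳ-≤ 2 (numMaxStableContaining≤Avoiding-of-adj (Adj-sym vu)))
              (≤-reflexive (trans (cong (2 *_) (sym halved)) twice-containing))

  satisfiesFrankl-of-rare-edge : ∀ {a b} → Adj G a b → Rare G a → Rare G b → SatisfiesFrankl G
  satisfiesFrankl-of-rare-edge {a} {b} ab a-rare b-rare X bip with a ∈? X
  ... | yes a∈X = (a , a∈X , a-rare) , (b , adj-∈⇒∉ bip ab a∈X , b-rare)
  ... | no  a∉X = (b , adj-∉⇒∈ bip ab a∉X , b-rare) , (a , a∉X , a-rare)

  -- Exchanging v for its neighbourhood

  module _ {v p : Fin n} (vp : Adj G v p) (p-pendant : Pendant G p) (N⟨v⟩-stable : Stable N⟨ v ⟩)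
           (layered : ∀ u → Adj G v u → ¬ Pendant G u → TwoLayered G u) where

    exclude : Subset n → Subset n
    exclude S = (S - v) ∪ (N⟨ v ⟩ ─ N[ S - v ])

    include : Subset n → Subset n
    include T = ⁅ v ⁆ ∪ (T ─ N⟨ v ⟩)

    ∈exclude⁺ˡ : ∀ {S x} → x ∈ S → x ≢ v → x ∈ exclude S
    ∈exclude⁺ˡ x∈S x≢v = x∈p∪q⁺ (inj₁ (x∈p∧x≢y⇒x∈p-y x∈S x≢v))

    ∈exclude⁺ʳ : ∀ {S x} → Adj G v x → x ∉ N[ S - v ] → x ∈ exclude S
    ∈exclude⁺ʳ vx x∉N = x∈p∪q⁺ (inj₂ (x∈p∧x∉q⇒x∈p─q (∈-setOf⁺ (Adj? v) vx) x∉N))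

    ∈exclude⁻ : ∀ {S x} → x ∈ exclude S → (x ∈ S × x ≢ v) ⊎ (Adj G v x × x ∉ N[ S - v ])
    ∈exclude⁻ {S} x∈ with x∈p∪q⁻ (S - v) _ x∈
    ... | inj₁ x∈S-v = inj₁ (p─q⊆p S ⁅ v ⁆ x∈S-v , ∈-minus⇒≢ x∈S-v)
    ... | inj₂ x∈new = inj₂ (∈-setOf⁻ (Adj? v) (p─q⊆p N⟨ v ⟩ N[ S - v ] x∈new) ,
                             x∈p─q⇒x∉q N⟨ v ⟩ N[ S - v ] x∈new)

    v∉exclude : ∀ {S} → v ∉ exclude S
    v∉exclude v∈ with ∈exclude⁻ v∈
    ... | inj₁ (_ , v≢v) = v≢v refl
    ... | inj₂ (vv , _)  = Adj-irrefl vv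

    v∈include : ∀ {T} → v ∈ include T
    v∈include = x∈p∪q⁺ (inj₁ (x∈⁅x⁆ v))

    ∈include⁺ : ∀ {T x} → x ∈ T → ¬ Adj G v x → x ∈ include T
    ∈include⁺ x∈T ¬vx = x∈p∪q⁺ (inj₂ (x∈p∧x∉q⇒x∈p─q x∈T (¬vx ∘ ∈-setOf⁻ (Adj? v))))

    ∈include⁻ : ∀ {T x} → x ∈ include T → x ≡ v ⊎ (x ∈ T × ¬ Adj G v x)
    ∈include⁻ {T} x∈ with x∈p∪q⁻ ⁅ v ⁆ _ x∈
    ... | inj₁ x∈⁅v⁆ = inj₁ (x∈⁅y⁆⇒x≡y v x∈⁅v⁆)
    ... | inj₂ x∈T─N = inj₂ (p─q⊆p T N⟨ v ⟩ x∈T─N , x∈p─q⇒x∉q T N⟨ v ⟩ x∈T─N ∘ ∈-setOf⁺ (Adj? v))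

    exclude-stable : ∀ {S} → Stable S → Stable (exclude S)
    exclude-stable st i∈ j∈ ij with ∈exclude⁻ i∈ | ∈exclude⁻ j∈
    ... | inj₁ (i∈S , _)   | inj₁ (j∈S , _)   = st i∈S j∈S ij
    ... | inj₁ (i∈S , i≢v) | inj₂ (_ , j∉N)   = j∉N (∈N[]⁺ (x∈p∧x≢y⇒x∈p-y i∈S i≢v) (Adj-sym ij))
    ... | inj₂ (_ , i∉N)   | inj₁ (j∈S , j≢v) = i∉N (∈N[]⁺ (x∈p∧x≢y⇒x∈p-y j∈S j≢v) ij)
    ... | inj₂ (vi , _)    | inj₂ (vj , _)    =
      N⟨v⟩-stable (∈-setOf⁺ (Adj? v) vi) (∈-setOf⁺ (Adj? v) vj) ij

    exclude-maximal : ∀ {S} → MaximalStable S → MaximalStable (exclude S)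
    exclude-maximal {S} (stable , dominating) = exclude-stable stable , exclude-dominating
      where
      p∉N[S-v] : p ∉ N[ S - v ]
      p∉N[S-v] p∈ with y , y∈S-v , py ← ∈N[]⁻ p∈ =
        ∈-minus⇒≢ y∈S-v (pendant-nbr-unique p-pendant py (Adj-sym vp))

      exclude-dominating : ∀ {x} → x ∉ exclude S → x ∈ N[ exclude S ]
      exclude-dominating {x} x∉ with x ≟ v
      ... | yes refl = ∈N[]⁺ (∈exclude⁺ʳ vp p∉N[S-v]) vp
      ... | no  x≢v with ∈N[]⁻ (dominating (x∉ ∘ flip ∈exclude⁺ˡ x≢v))
      ... | y , y∈S , xy with y ≟ v
      ...   | no  y≢v  = N[]-mono (p⊆p∪q _) (∈N[]⁺ (x∈p∧x≢y⇒x∈p-y y∈S y≢v) xy)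
      ...   | yes refl with x ∈? N[ S - v ]
      ...     | yes x∈N = N[]-mono (p⊆p∪q _) x∈N
      ...     | no  x∉N = contradiction (∈exclude⁺ʳ (Adj-sym xy) x∉N) x∉

    include-stable : ∀ {T} → Stable T → Stable (include T)
    include-stable st i∈ j∈ ij with ∈include⁻ i∈ | ∈include⁻ j∈
    ... | inj₁ refl         | inj₁ refl         = Adj-irrefl ij
    ... | inj₁ refl         | inj₂ (_ , ¬vj)    = ¬vj ij
    ... | inj₂ (_ , ¬vi)    | inj₁ refl         = ¬vi (Adj-sym ij)
    ... | inj₂ (i∈T , _)    | inj₂ (j∈T , _)    = st i∈T j∈T ij

    include-maximal : ∀ {T} → MaximalStable T → MaximalStable (include T)
    include-maximal {T} (stable , dominating) = include-stable stable , include-dominating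
      where
      -- y has the two neighbours x and v, so it is 2-layered: x sees a pendant q, and q ∈ T,
      -- since otherwise T would dominate q through its only neighbour x ∉ T.
      via-nbr-of-v : ∀ {x y} → x ∉ T → x ≢ v → Adj G v y → Adj G x y → x ∈ N[ include T ]
      via-nbr-of-v {x} {y} x∉T x≢v vy xy with degree G y ≟ℕ 1
      ... | yes y-pendant = contradiction (pendant-nbr-unique y-pendant (Adj-sym xy) (Adj-sym vy)) x≢v
      ... | no  y-not-pendant with q , q-pendant , xq ← layered y vy y-not-pendant x (Adj-sym xy)
                              with q ∈? T
      ...   | yes q∈T = ∈N[]⁺ (∈include⁺ q∈T ¬vq) xq
        where
        ¬vq : ¬ Adj G v q
        ¬vq vq = x≢v (pendant-nbr-unique q-pendant (Adj-sym xq) (Adj-sym vq))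
      ...   | no  q∉T with z , z∈T , qz ← ∈N[]⁻ (dominating q∉T) =
        contradiction (subst (_∈ T) (pendant-nbr-unique q-pendant qz (Adj-sym xq)) z∈T) x∉T

      include-dominating : ∀ {x} → x ∉ include T → x ∈ N[ include T ]
      include-dominating {x} x∉ with Adj? v x
      ... | yes vx = ∈N[]⁺ v∈include (Adj-sym vx)
      ... | no  ¬vx with y , y∈T , xy ← ∈N[]⁻ (dominating (x∉ ∘ flip ∈include⁺ ¬vx)) with Adj? v y
      ...   | no  ¬vy = ∈N[]⁺ (∈include⁺ y∈T ¬vy) xy
      ...   | yes vy  = via-nbr-of-v (x∉ ∘ flip ∈include⁺ ¬vx) (λ { refl → x∉ v∈include }) vy xy

    include∘exclude : ∀ {S} → Stable S → v ∈ S → include (exclude S) ≡ S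
    include∘exclude {S} stable v∈S = ⊆-antisym ⊆S S⊆
      where
      ⊆S : include (exclude S) ⊆ S
      ⊆S x∈ with ∈include⁻ x∈
      ... | inj₁ refl = v∈S
      ... | inj₂ (x∈exclude , ¬vx) with ∈exclude⁻ x∈exclude
      ...   | inj₁ (x∈S , _) = x∈S
      ...   | inj₂ (vx , _)  = contradiction vx ¬vx

      S⊆ : S ⊆ include (exclude S)
      S⊆ {x} x∈S with x ≟ v
      ... | yes refl = v∈include
      ... | no  x≢v  = ∈include⁺ (∈exclude⁺ˡ x∈S x≢v) (stable v∈S x∈S)

    exclude∘include : ∀ {T} → MaximalStable T → v ∉ T → exclude (include T) ≡ T
    exclude∘include {T} (stable , dominating) v∉T = ⊆-antisym ⊆T T⊆
      where
      ∈include-v⁻ : ∀ {y} → y ∈ include T - v → y ∈ T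
      ∈include-v⁻ y∈ with ∈include⁻ (p─q⊆p (include T) ⁅ v ⁆ y∈)
      ... | inj₁ y≡v       = contradiction y≡v (∈-minus⇒≢ y∈)
      ... | inj₂ (y∈T , _) = y∈T

      ⊆T : exclude (include T) ⊆ T
      ⊆T {x} x∈ with ∈exclude⁻ x∈
      ... | inj₁ (x∈include , x≢v) = ∈include-v⁻ (x∈p∧x≢y⇒x∈p-y x∈include x≢v)
      ... | inj₂ (vx , x∉N) with x ∈? T
      ...   | yes x∈T = x∈T
      ...   | no  x∉T with y , y∈T , xy ← ∈N[]⁻ (dominating x∉T) =
        contradiction (∈N[]⁺ (x∈p∧x≢y⇒x∈p-y (∈include⁺ y∈T ¬vy) y≢v) xy) x∉N
        where
        ¬vy : ¬ Adj G v y
        ¬vy vy = N⟨v⟩-stable (∈-setOf⁺ (Adj? v) vx) (∈-setOf⁺ (Adj? v) vy) xy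
        y≢v : y ≢ v
        y≢v refl = v∉T y∈T

      T⊆ : T ⊆ exclude (include T)
      T⊆ {x} x∈T with Adj? v x
      ... | no  ¬vx = ∈exclude⁺ˡ (∈include⁺ x∈T ¬vx) (λ { refl → v∉T x∈T })
      ... | yes vx  = ∈exclude⁺ʳ vx λ x∈N →
        let y , y∈ , xy = ∈N[]⁻ x∈N in stable x∈T (∈include-v⁻ y∈) xy

    numMaxStableContaining≡Avoiding : numMaxStableContaining G v ≡ numMaxStableAvoiding v
    numMaxStableContaining≡Avoiding =
      length-filterᵇ-≡-bijection (allSubsets-unique n) allSubsets-complete exclude include
      (λ {S} t → let ms , v∈S = containing⁻ {S} t in
        avoiding⁺ (exclude-maximal ms) v∉exclude , include∘exclude (proj₁ ms) v∈S)
      (λ {T} t → let ms , v∉T = avoiding⁻ {T} t in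
        containing⁺ (include-maximal ms) v∈include , exclude∘include ms v∉T)

proposition3p7 : (n : ℕ) (G : Graph n) → Bipartite G → (v : Fin n) →
    (Σ (Fin n) λ p → Pendant G p × Adj G v p) →
    (∀ u → Adj G v u → ¬ Pendant G u → TwoLayered G u) →
    SatisfiesFrankl G × Rare G v × (∀ u → Adj G v u → Rare G u)
proposition3p7 n G bipartite v (p , p-pendant , vp) layered =
  satisfiesFrankl-of-rare-edge G vp v-rare (nbr-rare p vp) , v-rare , nbr-rare
  where
  v-halved : numMaxStableContaining G v ≡ numMaxStableAvoiding G v
  v-halved = numMaxStableContaining≡Avoiding G vp p-pendant (N⟨⟩-stable G bipartite v) layered

  v-rare : Rare G v
  v-rare = rare-of-halved G v-halved

  nbr-rare : ∀ u → Adj G v u → Rare G u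
  nbr-rare u vu = rare-of-adj-halved G v-halved vu
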